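{- Let $k\ge 3$. For $2\le n\le k-1$, the word obtained from $W^{(k)}_n$ by deleting its last letter $n$ is a palindrome.
   Context: The alphabet is $\mathbb{N}=\{0,1,2,\dots\}$. For an integer $k\ge 3$, $\varphi_k$ is the morphism of $\mathbb{N}^*$ defined on letters, for $i\ge 0$ and $0\le j\le k-1$, by $\varphi_k(ki+j)=(ki)(ki+j+1)$ (two letters) if $0\le j\le k-2$, and $\varphi_k(ki+k-1)=(ki+k)$ (one letter). For $n\ge 0$, $W^{(k)}_n=\varphi_k^n(0)$. A palindrome is a word equal to its reversal. -}

module Defs where

open import Data.Nat using (ℕ; zero; suc; _+_; _*_; _≤_; _<_; _≟_)
open import Data.Nat.DivMod using (_/_; _%_)
open import Data.List using (List; []; _∷_; [_]; concatMap; reverse)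
open import Relation.Nullary using (yes; no)
open import Relation.Binary.PropositionalEquality using (_≡_)

-- The morphism φ_k on a single letter m = k*i + j (0 ≤ j ≤ k-1), for k = suc k'.
-- i = m / k, j = m % k.
-- φ_k(ki+j) = (ki)(ki+j+1) if j ≤ k-2, φ_k(ki+k-1) = (ki+k).
φLetter : (k' : ℕ) → ℕ → List ℕ
φLetter k' m with suc (m % suc k') ≟ suc k'
... | yes _ = (suc k' * (m / suc k') + suc k') ∷ []
... | no  _ = (suc k' * (m / suc k')) ∷ (suc k' * (m / suc k') + suc (m % suc k')) ∷ []

φ : (k' : ℕ) → List ℕ → List ℕ
φ k' = concatMap (φLetter k')

W : (k' : ℕ) → ℕ → List ℕ
W k' zero    = 0 ∷ []
W k' (suc n) = φ k' (W k' n)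

Palindrome : List ℕ → Set
Palindrome w = reverse w ≡ w

-- While n ≤ k − 1 every letter m < n lies in the first block {0,…,k−1}, where
-- φ_k(m) = 0 (m+1). Writing Z_0 = ε, Z_{n+1} = Z_n n Z_n for the Zimin words,
-- this gives φ_k(Z_n) 0 = Z_{n+1}, hence W_n = Z_n n by induction on n;
-- and Z_n is a palindrome.
module Submission where

open import Defs
open import Data.Nat using (ℕ; zero; suc; _≤_; _<_; _≟_)
open import Data.Nat.Properties using (<⇒≢; <⇒≤; m<n⇒m<1+n; suc-injective; *-zeroʳ)
open import Data.Nat.DivMod using (_%_; _/_; m<n⇒m%n≡m; m<n⇒m/n≡0)
open import Data.List using (List; []; _∷_; [_]; _++_; reverse)
open import Data.List.Properties using (concatMap-++; reverse-++; ++-assoc)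
open import Data.Product using (Σ; _×_; _,_)
open import Relation.Nullary using (yes; no; contradiction)
open import Relation.Binary.PropositionalEquality using (_≡_; refl; sym; trans; cong; cong₂; module ≡-Reasoning)
open ≡-Reasoning

zimin : ℕ → List ℕ
zimin zero    = []
zimin (suc n) = zimin n ++ n ∷ zimin n

zimin-palindrome : ∀ n → Palindrome (zimin n)
zimin-palindrome zero    = refl
zimin-palindrome (suc n) = begin
  reverse (zimin n ++ n ∷ zimin n)                 ≡⟨ reverse-++ (zimin n) (n ∷ zimin n) ⟩
  reverse (n ∷ zimin n) ++ reverse (zimin n)       ≡⟨ cong (_++ reverse (zimin n)) (reverse-++ [ n ] (zimin n)) ⟩
  (reverse (zimin n) ++ [ n ]) ++ reverse (zimin n) ≡⟨ cong₂ (λ u v → (u ++ [ n ]) ++ v) IH IH ⟩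
  (zimin n ++ [ n ]) ++ zimin n                    ≡⟨ ++-assoc (zimin n) [ n ] (zimin n) ⟩
  zimin n ++ n ∷ zimin n                           ∎
  where IH = zimin-palindrome n

φLetter-< : ∀ k' m → m < k' → φLetter k' m ≡ 0 ∷ suc m ∷ []
φLetter-< k' m m<k'
  with suc (m % suc k') ≟ suc k' | m<n⇒m%n≡m (m<n⇒m<1+n m<k') | m<n⇒m/n≡0 (m<n⇒m<1+n m<k')
... | yes m%+1≡k | m%≡m | _ = contradiction (trans (sym m%≡m) (suc-injective m%+1≡k)) (<⇒≢ m<k')
... | no  _      | m%≡m | m/≡0 rewrite m%≡m | m/≡0 | *-zeroʳ k' = refl

φ-++ : ∀ k' u v → φ k' (u ++ v) ≡ φ k' u ++ φ k' v
φ-++ k' = concatMap-++ (φLetter k')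

φ-zimin : ∀ k' n → n ≤ k' → φ k' (zimin n) ++ [ 0 ] ≡ zimin (suc n)
φ-zimin k' zero    _     = refl
φ-zimin k' (suc n) n<k' = begin
  φ k' (zimin n ++ n ∷ zimin n) ++ [ 0 ]        ≡⟨ cong (_++ [ 0 ]) (φ-++ k' (zimin n) (n ∷ zimin n)) ⟩
  (Φ ++ φLetter k' n ++ Φ) ++ [ 0 ]            ≡⟨ cong (λ u → (Φ ++ u ++ Φ) ++ [ 0 ]) (φLetter-< k' n n<k') ⟩
  (Φ ++ 0 ∷ suc n ∷ Φ) ++ [ 0 ]                ≡⟨ ++-assoc Φ (0 ∷ suc n ∷ Φ) [ 0 ] ⟩
  Φ ++ 0 ∷ suc n ∷ (Φ ++ [ 0 ])                ≡⟨ sym (++-assoc Φ [ 0 ] (suc n ∷ Φ ++ [ 0 ])) ⟩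
  (Φ ++ [ 0 ]) ++ suc n ∷ (Φ ++ [ 0 ])         ≡⟨ cong₂ (λ u v → u ++ suc n ∷ v) IH IH ⟩
  zimin (suc n) ++ suc n ∷ zimin (suc n)       ∎
  where
  Φ = φ k' (zimin n)
  IH = φ-zimin k' n (<⇒≤ n<k')

W≡zimin++[n] : ∀ k' n → n ≤ k' → W k' n ≡ zimin n ++ [ n ]
W≡zimin++[n] k' zero    _     = refl
W≡zimin++[n] k' (suc n) n<k' = begin
  φ k' (W k' n)                          ≡⟨ cong (φ k') (W≡zimin++[n] k' n (<⇒≤ n<k')) ⟩
  φ k' (zimin n ++ [ n ])                ≡⟨ φ-++ k' (zimin n) [ n ] ⟩
  Φ ++ φLetter k' n ++ []                ≡⟨ cong (λ u → Φ ++ u ++ []) (φLetter-< k' n n<k') ⟩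
  Φ ++ 0 ∷ suc n ∷ []                    ≡⟨ sym (++-assoc Φ [ 0 ] [ suc n ]) ⟩
  (Φ ++ [ 0 ]) ++ [ suc n ]              ≡⟨ cong (_++ [ suc n ]) (φ-zimin k' n (<⇒≤ n<k')) ⟩
  zimin (suc n) ++ [ suc n ]             ∎
  where Φ = φ k' (zimin n)

lemma5p2 : (k' n : ℕ) → 3 ≤ suc k' → 2 ≤ n → n ≤ k' →
    Σ (List ℕ) (λ w → (W k' n ≡ w ++ [ n ]) × Palindrome w)
lemma5p2 k' n _ _ n≤k' = zimin n , W≡zimin++[n] k' n n≤k' , zimin-palindrome n
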